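{- Let $q$ be an indeterminate and define power series $F_r(x)\in\mathbf{Z}[q][[x]]$ with constant term $1$ by $F_1(x)=1-x$ and $F_{r+1}(x)=F_r(qx)/F_r(x)$ for $r\ge1$. Then for every $r\ge 1$, every coefficient of $F_r(x)-1$ is divisible by $(q-1)^{r-1}$ in $\mathbf{Z}[q]$.
   Context: For every prime power $q$, evaluating the coefficient of $x^n$ in $F_r(x)$ at $q$ gives the $r$th equivariant reduced Euler characteristic $\widetilde{\chi}_r(\mathrm{L}_n^*(\mathbf{F}_q),\mathrm{GL}_n(\mathbf{F}_q))$ of the poset of nonzero proper subspaces of $\mathbf{F}_q^n$; here $\widetilde{\chi}_r(\Pi,G)=\frac{1}{|G|}\sum_{X\in\mathrm{Hom}(\mathbf{Z}^r,G)}\widetilde{\chi}(C_\Pi(X(\mathbf{Z}^r)))$ with $C_\Pi(H)$ the $H$-fixed subposet and $\widetilde{\chi}$ the reduced Euler characteristic. -}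

module Defs where

open import Data.Nat using (ℕ; zero; suc)
open import Data.Integer using (ℤ; +_; -[1+_]; _+_; _*_; -_)
open import Data.List using (List; []; _∷_; map; replicate; _++_)
open import Data.Product using (∃)
open import Relation.Binary.PropositionalEquality using (_≡_)

-- Polynomials in ℤ[q]: coefficient lists, lowest degree first.
-- Equality of polynomials is coefficientwise (trailing zeros irrelevant).

Poly : Set
Poly = List ℤ

coeffP : Poly → ℕ → ℤ
coeffP []       _       = + 0
coeffP (a ∷ _)  zero    = a
coeffP (_ ∷ as) (suc i) = coeffP as i

0P : Poly
0P = []

1P : Poly
1P = + 1 ∷ []

infixl 6 _+P_ _-P_
infixl 7 _*P_

_+P_ : Poly → Poly → Poly
[]       +P ys       = ys
(x ∷ xs) +P []       = x ∷ xs
(x ∷ xs) +P (y ∷ ys) = (x + y) ∷ (xs +P ys)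

negP : Poly → Poly
negP = map -_

_-P_ : Poly → Poly → Poly
a -P b = a +P negP b

scaleP : ℤ → Poly → Poly
scaleP c = map (c *_)

_*P_ : Poly → Poly → Poly
[]       *P ys = []
(x ∷ xs) *P ys = scaleP x ys +P (+ 0 ∷ (xs *P ys))

qMinus1 : Poly
qMinus1 = -[1+ 0 ] ∷ + 1 ∷ []

powP : Poly → ℕ → Poly
powP p zero    = 1P
powP p (suc n) = p *P powP p n

mulQPow : ℕ → Poly → Poly
mulQPow n p = replicate n (+ 0) ++ p

_∣P_ : Poly → Poly → Set
a ∣P b = ∃ λ c → ∀ i → coeffP (a *P c) i ≡ coeffP b i

-- Formal power series in x over ℤ[q]: n ↦ coefficient of x^n.

Series : Set
Series = ℕ → Poly

oneS : Series
oneS zero    = 1P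
oneS (suc _) = 0P

oneMinusX : Series
oneMinusX zero          = 1P
oneMinusX (suc zero)    = -[1+ 0 ] ∷ []
oneMinusX (suc (suc _)) = 0P

_-S_ : Series → Series → Series
(f -S g) n = f n -P g n

substQX : Series → Series
substQX f n = mulQPow n (f n)

-- Division A / B for a series B with constant term 1:
-- G_0 = A_0,  G_n = A_n - Σ_{k=1}^{n} B_k G_{n-k}.
-- divList A B n = [G_n, G_{n-1}, …, G_0].
conv : Series → ℕ → List Poly → Poly
conv B k []       = 0P
conv B k (g ∷ gs) = B k *P g +P conv B (suc k) gs

divList : Series → Series → ℕ → List Poly
divList A B zero    = A zero ∷ []
divList A B (suc n) = (A (suc n) -P conv B 1 prev) ∷ prev
  where prev = divList A B n

headP : List Poly → Poly
headP []      = 0P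
headP (g ∷ _) = g

divS : Series → Series → Series
divS A B n = headP (divList A B n)

-- F_r for r ≥ 1 (F 0 is an unused dummy value):
-- F_1 = 1 - x,  F_{r+1}(x) = F_r(qx) / F_r(x).
F : ℕ → Series
F zero          = oneS
F (suc zero)    = oneMinusX
F (suc (suc r)) = divS (substQX (F (suc r))) (F (suc r))

-- Write p ≡ r (mod E) for E ∣ p - r.  The proof is an induction on r built on
-- two general facts about congruences of power series modulo a polynomial E:
--
--  * (division) if B₀ = 1 and A ≡ B (mod E) coefficientwise, then A/B ≡ 1
--    (mod E) coefficientwise; this follows from the recursion defining the
--    quotient, since every term B_k G_{n-k} with n - k ≥ 1 vanishes mod E;
--  * (q-shift) if D ∣ p then (q - 1) D ∣ q^n p - p, because
--    q^n p - p ≡ p - p ≡ 0 modulo (q - 1) D by the step q p - p = (q - 1) p.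
--
-- If F_r ≡ 1 modulo D = (q - 1)^(r-1), the q-shift fact gives
-- F_r(qx) ≡ F_r(x) modulo (q - 1) D, and the division fact then yields
-- F_{r+1} = F_r(qx)/F_r(x) ≡ 1 modulo (q - 1)^r.
module Submission where

open import Defs
open import Data.Nat using (ℕ; zero; suc; _+_; _≤_; _∸_)
open import Data.Nat.Properties using (+-identityʳ; +-suc)
open import Data.Integer using (ℤ; +_; -[1+_]; -_) renaming (_+_ to _⊕_; _*_ to _⊛_)
import Data.Integer.Properties as ℤ
open import Data.Integer.Tactic.RingSolver using (solve-∀)
open import Data.List using (List; []; _∷_)
open import Data.Product using (_,_)
open import Relation.Binary.PropositionalEquality
open ≡-Reasoning

shift : (ℕ → ℤ) → ℕ → ℤ
shift f zero    = + 0
shift f (suc i) = f i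

shift-cong : ∀ {f g} → (∀ j → f j ≡ g j) → ∀ i → shift f i ≡ shift g i
shift-cong f≡g zero    = refl
shift-cong f≡g (suc i) = f≡g i

shift-+ : ∀ f g i → shift (λ j → f j ⊕ g j) i ≡ shift f i ⊕ shift g i
shift-+ f g zero    = refl
shift-+ f g (suc i) = refl

shift-neg : ∀ f i → shift (λ j → - f j) i ≡ - shift f i
shift-neg f zero    = refl
shift-neg f (suc i) = refl

shift-zero : ∀ i → shift (λ _ → + 0) i ≡ + 0
shift-zero zero    = refl
shift-zero (suc i) = refl

shift-scale : ∀ x f i → shift (λ j → x ⊛ f j) i ≡ x ⊛ shift f i
shift-scale x f zero    = sym (ℤ.*-zeroʳ x)
shift-scale x f (suc i) = refl

coeff-+ : ∀ a b i → coeffP (a +P b) i ≡ coeffP a i ⊕ coeffP b i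
coeff-+ []       b        i       = sym (ℤ.+-identityˡ _)
coeff-+ (x ∷ xs) []       i       = sym (ℤ.+-identityʳ _)
coeff-+ (x ∷ xs) (y ∷ ys) zero    = refl
coeff-+ (x ∷ xs) (y ∷ ys) (suc i) = coeff-+ xs ys i

coeff-neg : ∀ a i → coeffP (negP a) i ≡ - coeffP a i
coeff-neg []       i       = refl
coeff-neg (x ∷ xs) zero    = refl
coeff-neg (x ∷ xs) (suc i) = coeff-neg xs i

coeff-- : ∀ a b i → coeffP (a -P b) i ≡ coeffP a i ⊕ - coeffP b i
coeff-- a b i = trans (coeff-+ a (negP b) i) (cong (coeffP a i ⊕_) (coeff-neg b i))

coeff-scale : ∀ c a i → coeffP (scaleP c a) i ≡ c ⊛ coeffP a i
coeff-scale c []       i       = sym (ℤ.*-zeroʳ c)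
coeff-scale c (x ∷ xs) zero    = refl
coeff-scale c (x ∷ xs) (suc i) = coeff-scale c xs i

coeff-q· : ∀ p i → coeffP (+ 0 ∷ p) i ≡ shift (coeffP p) i
coeff-q· p zero    = refl
coeff-q· p (suc i) = refl

coeff-* : ∀ x xs r i → coeffP ((x ∷ xs) *P r) i ≡ x ⊛ coeffP r i ⊕ shift (coeffP (xs *P r)) i
coeff-* x xs r i =
  trans (coeff-+ (scaleP x r) (+ 0 ∷ xs *P r) i) (cong₂ _⊕_ (coeff-scale x r i) (coeff-q· (xs *P r) i))

-- Equality of polynomials: agreement of all coefficients.  (A record, so
-- that both sides can be inferred from a proof.)

infix 4 _≈_
record _≈_ (p q : Poly) : Set where
  constructor coeffwise
  field coeff-≡ : ∀ i → coeffP p i ≡ coeffP q i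
open _≈_ public

≈-refl : ∀ {p} → p ≈ p
≈-refl = coeffwise λ _ → refl

≈-sym : ∀ {p q} → p ≈ q → q ≈ p
≈-sym p≈q = coeffwise λ i → sym (coeff-≡ p≈q i)

≈-trans : ∀ {p q r} → p ≈ q → q ≈ r → p ≈ r
≈-trans p≈q q≈r = coeffwise λ i → trans (coeff-≡ p≈q i) (coeff-≡ q≈r i)

+-cong : ∀ {a a′ b b′} → a ≈ a′ → b ≈ b′ → a +P b ≈ a′ +P b′
+-cong {a} {a′} {b} {b′} a≈a′ b≈b′ = coeffwise λ i → begin
  coeffP (a +P b) i           ≡⟨ coeff-+ a b i ⟩
  coeffP a i ⊕ coeffP b i     ≡⟨ cong₂ _⊕_ (coeff-≡ a≈a′ i) (coeff-≡ b≈b′ i) ⟩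
  coeffP a′ i ⊕ coeffP b′ i   ≡⟨ sym (coeff-+ a′ b′ i) ⟩
  coeffP (a′ +P b′) i         ∎

scale-cong : ∀ x {a a′} → a ≈ a′ → scaleP x a ≈ scaleP x a′
scale-cong x {a} {a′} a≈a′ = coeffwise λ i →
  trans (coeff-scale x a i) (trans (cong (x ⊛_) (coeff-≡ a≈a′ i)) (sym (coeff-scale x a′ i)))

q·-cong : ∀ {a a′} → a ≈ a′ → (+ 0 ∷ a) ≈ (+ 0 ∷ a′)
q·-cong a≈a′ = coeffwise λ where
  zero    → refl
  (suc i) → coeff-≡ a≈a′ i

+-identityʳ-P : ∀ p → p +P [] ≈ p
+-identityʳ-P p = coeffwise λ i → trans (coeff-+ p [] i) (ℤ.+-identityʳ _)

*-congʳ : ∀ a {b b′} → b ≈ b′ → a *P b ≈ a *P b′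
*-congʳ []       b≈b′ = ≈-refl
*-congʳ (x ∷ xs) b≈b′ = +-cong (scale-cong x b≈b′) (q·-cong (*-congʳ xs b≈b′))

*-zeroʳ : ∀ a → a *P [] ≈ []
*-zeroʳ []       = ≈-refl
*-zeroʳ (x ∷ xs) = coeffwise λ i → begin
  coeffP ((x ∷ xs) *P []) i                  ≡⟨ coeff-* x xs [] i ⟩
  x ⊛ + 0 ⊕ shift (coeffP (xs *P [])) i      ≡⟨ cong₂ _⊕_ (ℤ.*-zeroʳ x) (shift-cong (coeff-≡ (*-zeroʳ xs)) i) ⟩
  + 0 ⊕ shift (λ _ → + 0) i                  ≡⟨ ℤ.+-identityˡ _ ⟩
  shift (λ _ → + 0) i                        ≡⟨ shift-zero i ⟩
  + 0                                        ∎

*-identityˡ : ∀ p → 1P *P p ≈ p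
*-identityˡ p = coeffwise λ i → begin
  coeffP (1P *P p) i                         ≡⟨ coeff-* (+ 1) [] p i ⟩
  + 1 ⊛ coeffP p i ⊕ shift (λ _ → + 0) i     ≡⟨ cong₂ _⊕_ (ℤ.*-identityˡ (coeffP p i)) (shift-zero i) ⟩
  coeffP p i ⊕ + 0                           ≡⟨ ℤ.+-identityʳ _ ⟩
  coeffP p i                                 ∎

*-distribˡ-+ : ∀ a p r → a *P (p +P r) ≈ a *P p +P a *P r
*-distribˡ-+ []       p r = ≈-refl
*-distribˡ-+ (x ∷ xs) p r = coeffwise λ i → begin
  coeffP ((x ∷ xs) *P (p +P r)) i
    ≡⟨ coeff-* x xs (p +P r) i ⟩
  x ⊛ coeffP (p +P r) i ⊕ shift (coeffP (xs *P (p +P r))) i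
    ≡⟨ cong₂ (λ u v → x ⊛ u ⊕ v) (coeff-+ p r i) (shift-cong IH i) ⟩
  x ⊛ (coeffP p i ⊕ coeffP r i) ⊕ shift (λ j → coeffP (xs *P p) j ⊕ coeffP (xs *P r) j) i
    ≡⟨ cong (x ⊛ (coeffP p i ⊕ coeffP r i) ⊕_) (shift-+ (coeffP (xs *P p)) (coeffP (xs *P r)) i) ⟩
  x ⊛ (coeffP p i ⊕ coeffP r i) ⊕ (shift (coeffP (xs *P p)) i ⊕ shift (coeffP (xs *P r)) i)
    ≡⟨ regroup x (coeffP p i) (coeffP r i) _ _ ⟩
  (x ⊛ coeffP p i ⊕ shift (coeffP (xs *P p)) i) ⊕ (x ⊛ coeffP r i ⊕ shift (coeffP (xs *P r)) i)
    ≡⟨ sym (cong₂ _⊕_ (coeff-* x xs p i) (coeff-* x xs r i)) ⟩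
  coeffP ((x ∷ xs) *P p) i ⊕ coeffP ((x ∷ xs) *P r) i
    ≡⟨ sym (coeff-+ ((x ∷ xs) *P p) ((x ∷ xs) *P r) i) ⟩
  coeffP ((x ∷ xs) *P p +P (x ∷ xs) *P r) i
    ∎
  where
  IH : ∀ j → coeffP (xs *P (p +P r)) j ≡ coeffP (xs *P p) j ⊕ coeffP (xs *P r) j
  IH j = trans (coeff-≡ (*-distribˡ-+ xs p r) j) (coeff-+ (xs *P p) (xs *P r) j)
  regroup : ∀ (x a b s t : ℤ) → x ⊛ (a ⊕ b) ⊕ (s ⊕ t) ≡ (x ⊛ a ⊕ s) ⊕ (x ⊛ b ⊕ t)
  regroup = solve-∀

*-distribˡ-neg : ∀ a p → a *P negP p ≈ negP (a *P p)
*-distribˡ-neg []       p = ≈-refl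
*-distribˡ-neg (x ∷ xs) p = coeffwise λ i → begin
  coeffP ((x ∷ xs) *P negP p) i
    ≡⟨ coeff-* x xs (negP p) i ⟩
  x ⊛ coeffP (negP p) i ⊕ shift (coeffP (xs *P negP p)) i
    ≡⟨ cong₂ (λ u v → x ⊛ u ⊕ v) (coeff-neg p i) (shift-cong IH i) ⟩
  x ⊛ (- coeffP p i) ⊕ shift (λ j → - coeffP (xs *P p) j) i
    ≡⟨ cong (x ⊛ (- coeffP p i) ⊕_) (shift-neg (coeffP (xs *P p)) i) ⟩
  x ⊛ (- coeffP p i) ⊕ - shift (coeffP (xs *P p)) i
    ≡⟨ pull-neg x (coeffP p i) _ ⟩
  - (x ⊛ coeffP p i ⊕ shift (coeffP (xs *P p)) i)
    ≡⟨ sym (trans (coeff-neg ((x ∷ xs) *P p) i) (cong -_ (coeff-* x xs p i))) ⟩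
  coeffP (negP ((x ∷ xs) *P p)) i
    ∎
  where
  IH : ∀ j → coeffP (xs *P negP p) j ≡ - coeffP (xs *P p) j
  IH j = trans (coeff-≡ (*-distribˡ-neg xs p) j) (coeff-neg (xs *P p) j)
  pull-neg : ∀ (x a s : ℤ) → x ⊛ (- a) ⊕ (- s) ≡ - (x ⊛ a ⊕ s)
  pull-neg = solve-∀

*-distribʳ-+ : ∀ p r c → (p +P r) *P c ≈ p *P c +P r *P c
*-distribʳ-+ []       r        c = ≈-refl
*-distribʳ-+ (x ∷ xs) []       c = ≈-sym (+-identityʳ-P ((x ∷ xs) *P c))
*-distribʳ-+ (x ∷ xs) (y ∷ ys) c = coeffwise λ i → begin
  coeffP ((x ⊕ y ∷ xs +P ys) *P c) i
    ≡⟨ coeff-* (x ⊕ y) (xs +P ys) c i ⟩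
  (x ⊕ y) ⊛ coeffP c i ⊕ shift (coeffP ((xs +P ys) *P c)) i
    ≡⟨ cong ((x ⊕ y) ⊛ coeffP c i ⊕_) (trans (shift-cong IH i) (shift-+ (coeffP (xs *P c)) (coeffP (ys *P c)) i)) ⟩
  (x ⊕ y) ⊛ coeffP c i ⊕ (shift (coeffP (xs *P c)) i ⊕ shift (coeffP (ys *P c)) i)
    ≡⟨ regroup x y (coeffP c i) _ _ ⟩
  (x ⊛ coeffP c i ⊕ shift (coeffP (xs *P c)) i) ⊕ (y ⊛ coeffP c i ⊕ shift (coeffP (ys *P c)) i)
    ≡⟨ sym (trans (coeff-+ ((x ∷ xs) *P c) ((y ∷ ys) *P c) i) (cong₂ _⊕_ (coeff-* x xs c i) (coeff-* y ys c i))) ⟩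
  coeffP ((x ∷ xs) *P c +P (y ∷ ys) *P c) i
    ∎
  where
  IH : ∀ j → coeffP ((xs +P ys) *P c) j ≡ coeffP (xs *P c) j ⊕ coeffP (ys *P c) j
  IH j = trans (coeff-≡ (*-distribʳ-+ xs ys c) j) (coeff-+ (xs *P c) (ys *P c) j)
  regroup : ∀ (x y c s t : ℤ) → (x ⊕ y) ⊛ c ⊕ (s ⊕ t) ≡ (x ⊛ c ⊕ s) ⊕ (y ⊛ c ⊕ t)
  regroup = solve-∀

scale-*-assoc : ∀ x b c → scaleP x b *P c ≈ scaleP x (b *P c)
scale-*-assoc x []       c = ≈-refl
scale-*-assoc x (y ∷ ys) c = coeffwise λ i → begin
  coeffP ((x ⊛ y ∷ scaleP x ys) *P c) i
    ≡⟨ coeff-* (x ⊛ y) (scaleP x ys) c i ⟩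
  (x ⊛ y) ⊛ coeffP c i ⊕ shift (coeffP (scaleP x ys *P c)) i
    ≡⟨ cong ((x ⊛ y) ⊛ coeffP c i ⊕_) (trans (shift-cong IH i) (shift-scale x (coeffP (ys *P c)) i)) ⟩
  (x ⊛ y) ⊛ coeffP c i ⊕ x ⊛ shift (coeffP (ys *P c)) i
    ≡⟨ factor x y (coeffP c i) _ ⟩
  x ⊛ (y ⊛ coeffP c i ⊕ shift (coeffP (ys *P c)) i)
    ≡⟨ sym (trans (coeff-scale x ((y ∷ ys) *P c) i) (cong (x ⊛_) (coeff-* y ys c i))) ⟩
  coeffP (scaleP x ((y ∷ ys) *P c)) i
    ∎
  where
  IH : ∀ j → coeffP (scaleP x ys *P c) j ≡ x ⊛ coeffP (ys *P c) j
  IH j = trans (coeff-≡ (scale-*-assoc x ys c) j) (coeff-scale x (ys *P c) j)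
  factor : ∀ (x y c s : ℤ) → (x ⊛ y) ⊛ c ⊕ x ⊛ s ≡ x ⊛ (y ⊛ c ⊕ s)
  factor = solve-∀

*-assoc : ∀ a b c → (a *P b) *P c ≈ a *P (b *P c)
*-assoc []       b c = ≈-refl
*-assoc (x ∷ xs) b c = coeffwise λ i → begin
  coeffP ((scaleP x b +P (+ 0 ∷ xs *P b)) *P c) i
    ≡⟨ coeff-≡ (*-distribʳ-+ (scaleP x b) (+ 0 ∷ xs *P b) c) i ⟩
  coeffP (scaleP x b *P c +P (+ 0 ∷ xs *P b) *P c) i
    ≡⟨ coeff-+ (scaleP x b *P c) ((+ 0 ∷ xs *P b) *P c) i ⟩
  coeffP (scaleP x b *P c) i ⊕ coeffP ((+ 0 ∷ xs *P b) *P c) i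
    ≡⟨ cong₂ _⊕_ (trans (coeff-≡ (scale-*-assoc x b c) i) (coeff-scale x (b *P c) i)) (coeff-* (+ 0) (xs *P b) c i) ⟩
  x ⊛ coeffP (b *P c) i ⊕ (+ 0 ⊛ coeffP c i ⊕ shift (coeffP ((xs *P b) *P c)) i)
    ≡⟨ cong (x ⊛ coeffP (b *P c) i ⊕_) (trans (ℤ.+-identityˡ _) (shift-cong (coeff-≡ (*-assoc xs b c)) i)) ⟩
  x ⊛ coeffP (b *P c) i ⊕ shift (coeffP (xs *P (b *P c))) i
    ≡⟨ sym (coeff-* x xs (b *P c) i) ⟩
  coeffP ((x ∷ xs) *P (b *P c)) i
    ∎

*-consʳ : ∀ b x ys → b *P (x ∷ ys) ≈ scaleP x b +P (+ 0 ∷ b *P ys)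
*-consʳ []       x ys = coeffwise λ where
  zero    → refl
  (suc i) → refl
*-consʳ (y ∷ bs) x ys = coeffwise at
  where
  IH : ∀ j → coeffP (bs *P (x ∷ ys)) j ≡ x ⊛ coeffP bs j ⊕ shift (coeffP (bs *P ys)) j
  IH j = trans (coeff-≡ (*-consʳ bs x ys) j)
    (trans (coeff-+ (scaleP x bs) (+ 0 ∷ bs *P ys) j) (cong₂ _⊕_ (coeff-scale x bs j) (coeff-q· (bs *P ys) j)))
  swap-middle : ∀ (x y a b s : ℤ) → y ⊛ a ⊕ (x ⊛ b ⊕ s) ≡ x ⊛ b ⊕ (y ⊛ a ⊕ s)
  swap-middle = solve-∀
  at : ∀ i → coeffP ((y ∷ bs) *P (x ∷ ys)) i ≡ coeffP (scaleP x (y ∷ bs) +P (+ 0 ∷ (y ∷ bs) *P ys)) i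
  at zero = begin
    coeffP ((y ∷ bs) *P (x ∷ ys)) 0               ≡⟨ coeff-* y bs (x ∷ ys) 0 ⟩
    y ⊛ x ⊕ + 0                                   ≡⟨ cong (_⊕ + 0) (ℤ.*-comm y x) ⟩
    x ⊛ y ⊕ + 0                                   ≡⟨ sym (coeff-+ (scaleP x (y ∷ bs)) (+ 0 ∷ (y ∷ bs) *P ys) 0) ⟩
    coeffP (scaleP x (y ∷ bs) +P (+ 0 ∷ (y ∷ bs) *P ys)) 0 ∎
  at (suc i) = begin
    coeffP ((y ∷ bs) *P (x ∷ ys)) (suc i)
      ≡⟨ coeff-* y bs (x ∷ ys) (suc i) ⟩
    y ⊛ coeffP ys i ⊕ coeffP (bs *P (x ∷ ys)) i
      ≡⟨ cong (y ⊛ coeffP ys i ⊕_) (IH i) ⟩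
    y ⊛ coeffP ys i ⊕ (x ⊛ coeffP bs i ⊕ shift (coeffP (bs *P ys)) i)
      ≡⟨ swap-middle x y (coeffP ys i) (coeffP bs i) _ ⟩
    x ⊛ coeffP bs i ⊕ (y ⊛ coeffP ys i ⊕ shift (coeffP (bs *P ys)) i)
      ≡⟨ sym (cong (x ⊛ coeffP bs i ⊕_) (coeff-* y bs ys i)) ⟩
    x ⊛ coeffP bs i ⊕ coeffP ((y ∷ bs) *P ys) i
      ≡⟨ sym (trans (coeff-+ (scaleP x (y ∷ bs)) (+ 0 ∷ (y ∷ bs) *P ys) (suc i))
                    (cong (_⊕ coeffP ((y ∷ bs) *P ys) i) (coeff-scale x bs i))) ⟩
    coeffP (scaleP x (y ∷ bs) +P (+ 0 ∷ (y ∷ bs) *P ys)) (suc i)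
      ∎

*-comm : ∀ a b → a *P b ≈ b *P a
*-comm []       b = ≈-sym (*-zeroʳ b)
*-comm (x ∷ xs) b = ≈-sym (≈-trans (*-consʳ b x xs) (+-cong ≈-refl (q·-cong (*-comm b xs))))

*-congˡ : ∀ {a a′} b → a ≈ a′ → a *P b ≈ a′ *P b
*-congˡ {a} {a′} b a≈a′ = ≈-trans (*-comm a b) (≈-trans (*-congʳ b a≈a′) (*-comm b a′))

*-identityʳ : ∀ p → p *P 1P ≈ p
*-identityʳ p = ≈-trans (*-comm p 1P) (*-identityˡ p)

q·-as-* : ∀ p → (+ 0 ∷ + 1 ∷ []) *P p ≈ (+ 0 ∷ p)
q·-as-* p = coeffwise λ i → begin
  coeffP ((+ 0 ∷ 1P) *P p) i                      ≡⟨ coeff-* (+ 0) 1P p i ⟩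
  + 0 ⊛ coeffP p i ⊕ shift (coeffP (1P *P p)) i   ≡⟨ ℤ.+-identityˡ _ ⟩
  shift (coeffP (1P *P p)) i                      ≡⟨ shift-cong (coeff-≡ (*-identityˡ p)) i ⟩
  shift (coeffP p) i                              ≡⟨ sym (coeff-q· p i) ⟩
  coeffP (+ 0 ∷ p) i                              ∎

qMinus1-* : ∀ p → qMinus1 *P p ≈ (+ 0 ∷ p) -P p
qMinus1-* p = coeffwise λ i → begin
  coeffP (qMinus1 *P p) i                           ≡⟨ coeff-* -[1+ 0 ] 1P p i ⟩
  -[1+ 0 ] ⊛ coeffP p i ⊕ shift (coeffP (1P *P p)) i
    ≡⟨ cong₂ _⊕_ (ℤ.-1*i≡-i (coeffP p i)) (shift-cong (coeff-≡ (*-identityˡ p)) i) ⟩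
  - coeffP p i ⊕ shift (coeffP p) i                 ≡⟨ ℤ.+-comm (- coeffP p i) _ ⟩
  shift (coeffP p) i ⊕ - coeffP p i                 ≡⟨ sym (trans (coeff-- (+ 0 ∷ p) p i) (cong (_⊕ - coeffP p i) (coeff-q· p i))) ⟩
  coeffP ((+ 0 ∷ p) -P p) i                         ∎

sub-≈-zero : ∀ {p r} → p ≈ r → [] ≈ p -P r
sub-≈-zero {p} {r} p≈r = coeffwise λ i → begin
  + 0                          ≡⟨ sym (ℤ.+-inverseʳ (coeffP r i)) ⟩
  coeffP r i ⊕ - coeffP r i    ≡⟨ cong (_⊕ - coeffP r i) (sym (coeff-≡ p≈r i)) ⟩
  coeffP p i ⊕ - coeffP r i    ≡⟨ sym (coeff-- p r i) ⟩
  coeffP (p -P r) i            ∎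

sub-telescope : ∀ p r s → (p -P r) +P (r -P s) ≈ p -P s
sub-telescope p r s = coeffwise λ i → begin
  coeffP ((p -P r) +P (r -P s)) i
    ≡⟨ trans (coeff-+ (p -P r) (r -P s) i) (cong₂ _⊕_ (coeff-- p r i) (coeff-- r s i)) ⟩
  (coeffP p i ⊕ - coeffP r i) ⊕ (coeffP r i ⊕ - coeffP s i)
    ≡⟨ telescope (coeffP p i) (coeffP r i) (coeffP s i) ⟩
  coeffP p i ⊕ - coeffP s i
    ≡⟨ sym (coeff-- p s i) ⟩
  coeffP (p -P s) i
    ∎
  where
  telescope : ∀ (a b c : ℤ) → (a ⊕ - b) ⊕ (b ⊕ - c) ≡ a ⊕ - c
  telescope = solve-∀

sub-+ : ∀ p p′ r r′ → (p -P p′) +P (r -P r′) ≈ (p +P r) -P (p′ +P r′)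
sub-+ p p′ r r′ = coeffwise λ i → begin
  coeffP ((p -P p′) +P (r -P r′)) i
    ≡⟨ trans (coeff-+ (p -P p′) (r -P r′) i) (cong₂ _⊕_ (coeff-- p p′ i) (coeff-- r r′ i)) ⟩
  (coeffP p i ⊕ - coeffP p′ i) ⊕ (coeffP r i ⊕ - coeffP r′ i)
    ≡⟨ regroup (coeffP p i) (coeffP p′ i) (coeffP r i) (coeffP r′ i) ⟩
  (coeffP p i ⊕ coeffP r i) ⊕ - (coeffP p′ i ⊕ coeffP r′ i)
    ≡⟨ sym (trans (coeff-- (p +P r) (p′ +P r′) i) (cong₂ (λ u v → u ⊕ - v) (coeff-+ p r i) (coeff-+ p′ r′ i))) ⟩
  coeffP ((p +P r) -P (p′ +P r′)) i
    ∎
  where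
  regroup : ∀ (a a′ b b′ : ℤ) → (a ⊕ - a′) ⊕ (b ⊕ - b′) ≡ (a ⊕ b) ⊕ - (a′ ⊕ b′)
  regroup = solve-∀

neg-distrib-sub : ∀ p r → negP (p -P r) ≈ negP p -P negP r
neg-distrib-sub p r = coeffwise λ i → begin
  coeffP (negP (p -P r)) i                 ≡⟨ trans (coeff-neg (p -P r) i) (cong -_ (coeff-- p r i)) ⟩
  - (coeffP p i ⊕ - coeffP r i)            ≡⟨ ℤ.neg-distrib-+ (coeffP p i) (- coeffP r i) ⟩
  - coeffP p i ⊕ - - coeffP r i            ≡⟨ sym (cong₂ (λ u v → u ⊕ - v) (coeff-neg p i) (coeff-neg r i)) ⟩
  coeffP (negP p) i ⊕ - coeffP (negP r) i  ≡⟨ sym (coeff-- (negP p) (negP r) i) ⟩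
  coeffP (negP p -P negP r) i              ∎

*-distribˡ-sub : ∀ a p r → a *P (p -P r) ≈ a *P p -P a *P r
*-distribˡ-sub a p r = ≈-trans (*-distribˡ-+ a p (negP r)) (+-cong ≈-refl (*-distribˡ-neg a r))

module Modulo (E : Poly) where

  -- Multiples of E form an ideal: closed under ≈, 0, +, - and products.
  -- (E ∣P p fixes p only through its coefficients, so these lemmas take
  -- their polynomials explicitly.)
  ∣-resp-≈ : ∀ {p p′} → p ≈ p′ → E ∣P p → E ∣P p′
  ∣-resp-≈ p≈p′ (c , Ec≡p) = c , λ i → trans (Ec≡p i) (coeff-≡ p≈p′ i)

  ∣-zero : E ∣P []
  ∣-zero = [] , coeff-≡ (*-zeroʳ E)

  ∣-+ : ∀ p r → E ∣P p → E ∣P r → E ∣P (p +P r)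
  ∣-+ p r (c , Ec≡p) (d , Ed≡r) =
    (c +P d) , coeff-≡ (≈-trans (*-distribˡ-+ E c d) (+-cong (coeffwise {E *P c} {p} Ec≡p) (coeffwise {E *P d} {r} Ed≡r)))

  ∣-neg : ∀ p → E ∣P p → E ∣P negP p
  ∣-neg p (c , Ec≡p) = negP c , λ i → begin
    coeffP (E *P negP c) i   ≡⟨ coeff-≡ (*-distribˡ-neg E c) i ⟩
    coeffP (negP (E *P c)) i ≡⟨ coeff-neg (E *P c) i ⟩
    - coeffP (E *P c) i      ≡⟨ cong -_ (Ec≡p i) ⟩
    - coeffP p i             ≡⟨ sym (coeff-neg p i) ⟩
    coeffP (negP p) i        ∎

  ∣-*ˡ : ∀ B p → E ∣P p → E ∣P (B *P p)
  ∣-*ˡ B p (c , Ec≡p) = (B *P c) , coeff-≡ E[Bc]≈Bp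
    where
    E[Bc]≈Bp : E *P (B *P c) ≈ B *P p
    E[Bc]≈Bp = ≈-trans (≈-sym (*-assoc E B c))
                 (≈-trans (*-congˡ c (*-comm E B)) (≈-trans (*-assoc B E c) (*-congʳ B (coeffwise {E *P c} {p} Ec≡p))))

  infix 4 _≋_
  record _≋_ (p r : Poly) : Set where
    constructor ≋-intro
    field ≋-elim : E ∣P (p -P r)
  open _≋_ public

  ≈⇒≋ : ∀ {p r} → p ≈ r → p ≋ r
  ≈⇒≋ p≈r = ≋-intro (∣-resp-≈ (sub-≈-zero p≈r) ∣-zero)

  ≋-refl : ∀ {p} → p ≋ p
  ≋-refl = ≈⇒≋ ≈-refl

  ≋-trans : ∀ {p r s} → p ≋ r → r ≋ s → p ≋ s
  ≋-trans {p} {r} {s} (≋-intro E∣p-r) (≋-intro E∣r-s) =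
    ≋-intro (∣-resp-≈ (sub-telescope p r s) (∣-+ (p -P r) (r -P s) E∣p-r E∣r-s))

  ≋-+ : ∀ {p p′ r r′} → p ≋ p′ → r ≋ r′ → (p +P r) ≋ (p′ +P r′)
  ≋-+ {p} {p′} {r} {r′} (≋-intro E∣p-p′) (≋-intro E∣r-r′) =
    ≋-intro (∣-resp-≈ (sub-+ p p′ r r′) (∣-+ (p -P p′) (r -P r′) E∣p-p′ E∣r-r′))

  ≋-neg : ∀ {p r} → p ≋ r → negP p ≋ negP r
  ≋-neg {p} {r} (≋-intro E∣p-r) = ≋-intro (∣-resp-≈ (neg-distrib-sub p r) (∣-neg (p -P r) E∣p-r))

  ≋-- : ∀ {p p′ r r′} → p ≋ p′ → r ≋ r′ → (p -P r) ≋ (p′ -P r′)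
  ≋-- p≋p′ r≋r′ = ≋-+ p≋p′ (≋-neg r≋r′)

  ≋-*ˡ : ∀ B {p r} → p ≋ r → (B *P p) ≋ (B *P r)
  ≋-*ˡ B {p} {r} (≋-intro E∣p-r) = ≋-intro (∣-resp-≈ (*-distribˡ-sub B p r) (∣-*ˡ B (p -P r) E∣p-r))

  -- (q p) - (q r) is, as a list, q (p - r); multiplying by q preserves ≋.
  ≋-q· : ∀ {p r} → p ≋ r → (+ 0 ∷ p) ≋ (+ 0 ∷ r)
  ≋-q· {p} {r} (≋-intro E∣p-r) =
    ≋-intro (∣-resp-≈ (q·-as-* (p -P r)) (∣-*ˡ (+ 0 ∷ + 1 ∷ []) (p -P r) E∣p-r))

module Division (E : Poly) (A B : Series) (B₀≈1 : B 0 ≈ 1P)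
                (E∣A-B : ∀ n → E ∣P (A n -P B n)) where
  open Modulo E

  -- A list [g_m, …, g_1, g_0] of polynomials with g_0 ≡ 1 and all other
  -- g_j ≡ 0 modulo E: the reversed prefixes of a series congruent to 1.
  data OneMod : ℕ → List Poly → Set where
    constant : ∀ {g} → g ≋ 1P → OneMod 0 (g ∷ [])
    _∷zero_  : ∀ {m g gs} → g ≋ [] → OneMod m gs → OneMod (suc m) (g ∷ gs)

  -- Against such a list, the convolution Σ_j B_{k+j} g_{m-j} collapses to
  -- its last term B_{k+m}.
  conv-OneMod : ∀ {m gs} k → OneMod m gs → conv B k gs ≋ B (k + m)
  conv-OneMod {gs = g ∷ []} k (constant g≋1) rewrite +-identityʳ k =
    ≋-trans (≈⇒≋ (+-identityʳ-P (B k *P g)))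
      (≋-trans (≋-*ˡ (B k) g≋1) (≈⇒≋ (*-identityʳ (B k))))
  conv-OneMod {suc m} {g ∷ gs} k (g≋0 ∷zero rest) rewrite +-suc k m =
    ≋-trans (≋-+ (≋-*ˡ (B k) g≋0) (conv-OneMod (suc k) rest))
      (≈⇒≋ (+-cong (*-zeroʳ (B k)) ≈-refl))

  divList-OneMod : ∀ n → OneMod n (divList A B n)
  divList-OneMod zero = constant (≋-trans (≋-intro (E∣A-B 0)) (≈⇒≋ B₀≈1))
  divList-OneMod (suc n) =
    ≋-trans (≋-- (≋-refl {A (suc n)}) (conv-OneMod 1 (divList-OneMod n)))
            (≋-intro (∣-resp-≈ (≈-sym (+-identityʳ-P (A (suc n) -P B (suc n)))) (E∣A-B (suc n))))
    ∷zero divList-OneMod n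

  head-OneMod : ∀ {n gs} → OneMod n gs → headP gs ≋ oneS n
  head-OneMod (constant g≋1)   = g≋1
  head-OneMod (g≋0 ∷zero _) = g≋0

  quotient-≋-one : ∀ n → E ∣P (divS A B n -P oneS n)
  quotient-≋-one n = ≋-elim (head-OneMod (divList-OneMod n))

qPow-sub : ∀ D n p → D ∣P p → (qMinus1 *P D) ∣P (mulQPow n p -P p)
qPow-sub D n p (c , Dc≡p) = ≋-elim (qPow≋ n)
  where
  open Modulo (qMinus1 *P D)
  q·p≋p : (+ 0 ∷ p) ≋ p
  q·p≋p = ≋-intro (c , coeff-≡ (≈-trans (*-assoc qMinus1 D c)
                    (≈-trans (*-congʳ qMinus1 (coeffwise {D *P c} {p} Dc≡p)) (qMinus1-* p))))
  qPow≋ : ∀ n → mulQPow n p ≋ p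
  qPow≋ zero    = ≋-refl
  qPow≋ (suc n) = ≋-trans (≋-q· (qPow≋ n)) q·p≋p

F-constant : ∀ k → F (suc k) 0 ≡ 1P
F-constant zero    = refl
F-constant (suc k) = F-constant k

F≋1 : ∀ k n → powP qMinus1 k ∣P (F (suc k) n -P oneS n)
F≋1 zero    n = (F 1 n -P oneS n) , coeff-≡ (*-identityˡ (F 1 n -P oneS n))
F≋1 (suc k)   = Division.quotient-≋-one (qMinus1 *P powP qMinus1 k) (substQX G) G G₀≈1 shift≋
  where
  G : Series
  G = F (suc k)
  G₀≈1 : G 0 ≈ 1P
  G₀≈1 = coeffwise λ i → cong (λ p → coeffP p i) (F-constant k)
  -- G(qx) ≡ G(x): the constant terms agree, and D divides every other G_n.
  shift≋ : ∀ n → (qMinus1 *P powP qMinus1 k) ∣P (mulQPow n (G n) -P G n)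
  shift≋ zero    = Modulo.≋-elim (Modulo.≋-refl (qMinus1 *P powP qMinus1 k) {G 0})
  shift≋ (suc m) = qPow-sub (powP qMinus1 k) (suc m) (G (suc m))
    (Modulo.∣-resp-≈ (powP qMinus1 k) (+-identityʳ-P (G (suc m))) (F≋1 k (suc m)))

corollary4p1 : ∀ (r : ℕ) → 1 ≤ r → ∀ (n : ℕ) → powP qMinus1 (r ∸ 1) ∣P ((F r -S oneS) n)
corollary4p1 zero    ()
corollary4p1 (suc k) _ n = F≋1 k n
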